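{- Let $k,q\ge1$ be integers, and let $Q$ be a finite multiset of integers with $0\le a\le k$ for all $a\in Q$ and $qk\le\sum_{a\in Q}a<(q+1)k$. Then there exists a partition $Q=Q_1\cup\cdots\cup Q_q$ (as multisets) such that $\sum_{a\in Q_i}a<2k$ for all $i\in\{1,\dots,q\}$. -}

module Defs where

open import Data.Nat using (ℕ)
open import Data.List using (List; concat)
open import Data.List.Relation.Binary.Permutation.Propositional using (_↭_)
open import Data.Vec using (Vec; toList)

-- A multiset of integers is represented as a list (order irrelevant;
-- equality of multisets is permutation _↭_).  Since all entries satisfy
-- 0 ≤ a, entries are natural numbers.

IsPartition : {q : ℕ} → Vec (List ℕ) q → List ℕ → Set
IsPartition parts Q = concat (toList parts) ↭ Q

{-# OPTIONS --safe #-}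
module Submission where

-- Fill the parts greedily: the first part is the shortest prefix of Q whose
-- sum reaches k (or all of Q).  Every element is at most k, so that prefix
-- sums to less than 2k, and removing it lowers the total by at least k.
-- Induction on q then leaves a remainder of sum below 2k for the last part.

open import Defs
open import Data.Nat using (ℕ; zero; suc; _≤_; _<_; _*_; _+_; _<?_)
open import Data.Nat.Properties
  using (+-assoc; +-comm; +-identityʳ; +-mono-<-≤; +-monoˡ-≤; +-cancelˡ-<; ≤-<-trans; <-≤-trans; m≤m+n; ≮⇒≥)
open import Data.List using (List; []; _∷_; _++_; [_])
open import Data.List.Properties using (++-identityʳ)
open import Data.List.Relation.Unary.All using (All; []; _∷_)
open import Data.List.Relation.Unary.All.Properties using (++⁻ʳ)
open import Data.List.Relation.Binary.Permutation.Propositional using (↭-reflexive)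
open import Data.List.Relation.Binary.Permutation.Propositional.Properties using (++⁺ˡ)
open import Data.Nat.ListAction using (sum)
open import Data.Nat.ListAction.Properties using (sum-++)
open import Data.Vec using (Vec; []; _∷_)
import Data.Vec.Relation.Unary.All as VAll
open import Data.Product using (Σ; _×_; _,_)
open import Data.Sum using (_⊎_; inj₁; inj₂)
import Data.Sum as Sum
open import Relation.Nullary using (yes; no)
open import Relation.Binary.PropositionalEquality using (_≡_; refl; sym; cong; subst)

SmallPartition : (k q : ℕ) → List ℕ → Set
SmallPartition k q Q =
  Σ (Vec (List ℕ) q) (λ parts → IsPartition parts Q × VAll.All (λ Qi → sum Qi < 2 * k) parts)

<⇒≤⇒+<2* : ∀ {m n k} → m < k → n ≤ k → m + n < 2 * k
<⇒≤⇒+<2* {m} {n} {k} m<k n≤k = subst (m + n <_) (cong (k +_) (sym (+-identityʳ k))) (+-mono-<-≤ m<k n≤k)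

record GreedyBlock (k load : ℕ) (Q : List ℕ) : Set where
  constructor greedy
  field
    block rest     : List ℕ
    block++rest≡Q  : block ++ rest ≡ Q
    block<2k       : load + sum block < 2 * k
    full⊎exhausted : k ≤ load + sum block ⊎ rest ≡ []

greedyBlock : ∀ {k} load (Q : List ℕ) → All (_≤ k) Q → load < k → GreedyBlock k load Q
greedyBlock {k} load [] [] load<k =
  greedy [] [] refl (<⇒≤⇒+<2* load<k (m≤m+n 0 k)) (inj₂ refl)
greedyBlock {k} load (x ∷ xs) (x≤k ∷ xs≤k) load<k with load + x <? k
... | yes load+x<k =
  let greedy block rest eq bound status = greedyBlock (load + x) xs xs≤k load+x<k
      reassoc = +-assoc load x (sum block)
  in greedy (x ∷ block) rest (cong (x ∷_) eq)
       (subst (_< 2 * k) reassoc bound)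
       (Sum.map₁ (subst (k ≤_) reassoc) status)
... | no load+x≮k =
  greedy [ x ] xs refl
    (subst (_< 2 * k) (load+x≡load+sum[x]) (<⇒≤⇒+<2* load<k x≤k))
    (inj₁ (subst (k ≤_) (load+x≡load+sum[x]) (≮⇒≥ load+x≮k)))
  where
  load+x≡load+sum[x] : load + x ≡ load + sum [ x ]
  load+x≡load+sum[x] = cong (load +_) (sym (+-identityʳ x))

smallPartition : ∀ {k} n → 1 ≤ k → (Q : List ℕ) → All (_≤ k) Q
  → sum Q < (2 + n) * k → SmallPartition k (suc n) Q
smallPartition zero _ Q _ ΣQ<2k = Q ∷ [] , ↭-reflexive (++-identityʳ Q) , ΣQ<2k VAll.∷ VAll.[]
smallPartition {k} (suc n) 1≤k Q Q≤k ΣQ<bound with greedyBlock 0 Q Q≤k 1≤k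
... | greedy P R refl ΣP<2k status =
  let parts , R↭ , small = smallPartition n 1≤k R (++⁻ʳ P Q≤k) (ΣR<bound status)
  in P ∷ parts , ++⁺ˡ P R↭ , ΣP<2k VAll.∷ small
  where
  ΣR<bound : k ≤ sum P ⊎ R ≡ [] → sum R < (2 + n) * k
  ΣR<bound (inj₂ refl) = <-≤-trans 1≤k (m≤m+n k _)
  ΣR<bound (inj₁ k≤ΣP) = +-cancelˡ-< k (sum R) _
    (≤-<-trans (+-monoˡ-≤ (sum R) k≤ΣP) (subst (_< (3 + n) * k) (sum-++ P R) ΣQ<bound))

lemma4p3 : (k q : ℕ) → 1 ≤ k → 1 ≤ q → (Q : List ℕ)
    → All (λ a → a ≤ k) Q
    → q * k ≤ sum Q → sum Q < (q + 1) * k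
    → Σ (Vec (List ℕ) q) (λ parts → IsPartition parts Q × VAll.All (λ Qi → sum Qi < 2 * k) parts)
lemma4p3 k (suc n) 1≤k _ Q Q≤k _ ΣQ<bound =
  smallPartition n 1≤k Q Q≤k (subst (λ m → sum Q < m * k) (+-comm (suc n) 1) ΣQ<bound)
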